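{- If $U$ is a star topology (a tree with a center node adjacent to all other nodes), then every vertex of the polyhedron of the STT LP for $U$ is integer.
   Context: For a tree $U$ and distinct nodes $i,j$, $(i\leftrightsquigarrow j)$ denotes the nodes strictly between $i$ and $j$ on the $U$-path. The STT LP for $U$ has variables $D_i$ ($i\in U$), $X_{ij}$ ($i\ne j$), $Z_{kij}=Z_{kji}$ ($k\in(i\leftrightsquigarrow j)$); constraints $X_{ij}\ge0$, $Z_{kij}\ge0$; for all $i\ne j$: $X_{ij}+X_{ji}+\sum_{k\in(i\leftrightsquigarrow j)}Z_{kij}\ge1$; $Z_{kij}\le X_{ki}$, $Z_{kij}\le X_{kj}$; $D_i\ge\sum_{j\ne i}X_{ji}$.
   Formalization: The points of the polyhedron of the STT LP, including the points against which extremality of a vertex is tested, have rational coordinates instead of real ones. -}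

module Defs where

open import Data.Nat using (ℕ; zero; suc)
open import Data.Fin using (Fin; zero; suc)
open import Data.Fin.Properties using (_≟_)
open import Data.Integer using (ℤ)
open import Data.Rational using (ℚ; 0ℚ; 1ℚ; _+_; _*_; _-_; _≤_; _<_; _/_)
open import Data.Product using (_×_; ∃-syntax)
open import Relation.Binary.PropositionalEquality using (_≡_; _≢_)
open import Relation.Nullary using (¬_; Dec; yes; no)
open import Relation.Nullary.Decidable using (_×-dec_; ¬?)

sumFin : ∀ {m} → (Fin m → ℚ) → ℚ
sumFin {zero}  f = 0ℚ
sumFin {suc m} f = f zero + sumFin (λ i → f (suc i))

when : ∀ {P : Set} → Dec P → ℚ → ℚ
when (yes _) q = q
when (no _)  _ = 0ℚ

-- Coordinates that are not genuine LP variables (X i i, Z k i j with k not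
-- strictly between i and j) are pinned to 0 by the polyhedron, and the
-- symmetry Z k i j = Z k j i is imposed; so the set of points below is
-- affinely isomorphic (by an integrality-preserving map) to the LP polyhedron.
record Point (m : ℕ) : Set where
  constructor pt
  field
    D : Fin m → ℚ
    X : Fin m → Fin m → ℚ
    Z : Fin m → Fin m → Fin m → ℚ
open Point public

-- A tree on nodes Fin m given through its "strictly between" relation:
-- Btw k i j  means  k ∈ (i ⇝ j).
module STT {m : ℕ} (Btw : Fin m → Fin m → Fin m → Set)
           (btw? : ∀ k i j → Dec (Btw k i j)) where

  record InP (p : Point m) : Set where
    field
      X-diag  : ∀ i → X p i i ≡ 0ℚ
      Z-off   : ∀ k i j → ¬ Btw k i j → Z p k i j ≡ 0ℚ
      Z-sym   : ∀ k i j → Btw k i j → Z p k i j ≡ Z p k j i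
      X-nonneg : ∀ i j → i ≢ j → 0ℚ ≤ X p i j
      Z-nonneg : ∀ k i j → i ≢ j → Btw k i j → 0ℚ ≤ Z p k i j
      cover   : ∀ i j → i ≢ j →
                1ℚ ≤ X p i j + X p j i + sumFin (λ k → when (btw? k i j) (Z p k i j))
      Z≤Xki   : ∀ k i j → i ≢ j → Btw k i j → Z p k i j ≤ X p k i
      Z≤Xkj   : ∀ k i j → i ≢ j → Btw k i j → Z p k i j ≤ X p k j
      D-bound : ∀ i → sumFin (λ j → when (¬? (j ≟ i)) (X p j i)) ≤ D p i

  comb : ℚ → Point m → Point m → Point m
  comb l q r = pt (λ i → l * D q i + (1ℚ - l) * D r i)
                  (λ i j → l * X q i j + (1ℚ - l) * X r i j)
                  (λ k i j → l * Z q k i j + (1ℚ - l) * Z r k i j)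

  _≐_ : Point m → Point m → Set
  p ≐ q = (∀ i → D p i ≡ D q i) × (∀ i j → X p i j ≡ X q i j)
          × (∀ k i j → Z p k i j ≡ Z q k i j)

  IsVertex : Point m → Set
  IsVertex p = InP p × (∀ q r l → InP q → InP r → 0ℚ < l → l < 1ℚ →
                         p ≐ comb l q r → q ≐ r)

IsInt : ℚ → Set
IsInt q = ∃[ z ] q ≡ z / 1

IsIntegral : ∀ {m} → Point m → Set
IsIntegral p = (∀ i → IsInt (D p i)) × (∀ i j → IsInt (X p i j))
               × (∀ k i j → IsInt (Z p k i j))

-- The star with n leaves: nodes Fin (suc n), center zero, leaves suc _.
-- The path between two distinct leaves is  i – center – j ; every other pair
-- of distinct nodes is adjacent.
StarBtw : ∀ {n} → Fin (suc n) → Fin (suc n) → Fin (suc n) → Set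
StarBtw k i j = (k ≡ zero) × ((i ≢ zero) × ((j ≢ zero) × (i ≢ j)))

starBtw? : ∀ {n} (k i j : Fin (suc n)) → Dec (StarBtw k i j)
starBtw? k i j = (k ≟ zero) ×-dec (¬? (i ≟ zero) ×-dec (¬? (j ≟ zero) ×-dec ¬? (i ≟ j)))

module StarSTT (n : ℕ) = STT {suc n} StarBtw starBtw?

module Submission where

-- At a vertex p the degree constraints are tight, so D is determined by X, and p is not
-- the midpoint of two other feasible points.  First, for distinct leaves a, b one of
-- X ab, X ba vanishes: otherwise moving min(X ab, X ba) from one to the other, in either
-- direction, leaves every sum X ij + X ji and the centre's row unchanged and so stays
-- feasible.  Next, 2v = low v + high v with low v = min(2v, 1) and high v = max(2v - 1, 0);
-- both maps are monotone, fix 0, and turn u + v ≥ 1 into low u + high v ≥ 1.  Applying low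
-- to the centre's row and to Z and high to the leaves' rows, or the other way round, gives
-- two feasible points with midpoint p: on a leaf pair one of X ab, X ba is 0, so the
-- covering sum involves only one leaf entry besides Z.  Hence p is fixed by low and high,
-- whose only fixed points are 0 and 1.

open import Defs
open import Data.Nat using (ℕ; zero; suc; s≤s; z≤n)
open import Data.Fin using (Fin; zero; suc)
open import Data.Fin.Properties using (_≟_; <-cmp)
open import Data.Integer as ℤ using (+<+)
import Data.Integer.Properties as ℤ
open import Data.Rational
  using (ℚ; 0ℚ; 1ℚ; _+_; _*_; _-_; -_; _≤_; _<_; _/_; _⊓_; _⊔_; *<*; toℚᵘ)
open import Data.Rational.Properties
  using ( ≤-refl; ≤-reflexive; ≤-trans; ≤-total; +-identityˡ; +-identityʳ; +-assoc; +-inverseʳ; +-comm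
        ; +-mono-≤; +-monoˡ-≤; +-monoʳ-≤; neg-injective; neg-distrib-+; positive⁻¹
        ; ⊓-sel; ⊓-comm; ⊓-glb; p⊓q≤p; ⊓-monoˡ-≤; ⊔-monoˡ-≤; p≤p⊔q; p≤q⊔p
        ; p≤q⇒p⊓q≡p; p≥q⇒p⊓q≡q; p≤q⇒p⊔q≡q; p≥q⇒p⊔q≡p
        ; module ≤-Reasoning; toℚᵘ-homo-+; toℚᵘ-fromℚᵘ; fromℚᵘ-toℚᵘ; fromℚᵘ-cong )
import Data.Rational.Unnormalised as ℚᵘ
import Data.Rational.Unnormalised.Properties as ℚᵘ
open import Data.Rational.Solver using (module +-*-Solver)
open import Data.Product using (_×_; _,_; proj₁; proj₂)
open import Data.Sum using (_⊎_; inj₁; inj₂)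
open import Data.Empty using (⊥-elim)
open import Relation.Binary.Definitions using (tri<; tri≈; tri>)
open import Relation.Binary.PropositionalEquality
open import Relation.Nullary using (Dec; yes; no)
open import Relation.Nullary.Decidable using (¬?)

open +-*-Solver

½ : ℚ
½ = ℤ.+ 1 / 2

0<½ : 0ℚ < ½
0<½ = positive⁻¹ ½

½<1 : ½ < 1ℚ
½<1 = *<* (+<+ (s≤s (s≤s z≤n)))

double-injective : ∀ {p q} → p + p ≡ q + q → p ≡ q
double-injective {p} {q} eq = begin
  p             ≡⟨ solve 1 (λ p → p := con ½ :* (p :+ p)) refl p ⟩
  ½ * (p + p)   ≡⟨ cong (½ *_) eq ⟩
  ½ * (q + q)   ≡⟨ solve 1 (λ q → con ½ :* (q :+ q) := q) refl q ⟩
  q             ∎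
  where open ≡-Reasoning

p+q≡p⇒q≡0 : ∀ {p q} → p + q ≡ p → q ≡ 0ℚ
p+q≡p⇒q≡0 {p} {q} eq = begin
  q             ≡⟨ solve 2 (λ p q → q := (p :+ q) :- p) refl p q ⟩
  (p + q) - p   ≡⟨ cong (_- p) eq ⟩
  p - p         ≡⟨ +-inverseʳ p ⟩
  0ℚ            ∎
  where open ≡-Reasoning

sum≡double⇒midpoint : ∀ {x} a b → a + b ≡ x + x → x ≡ ½ * a + (1ℚ - ½) * b
sum≡double⇒midpoint {x} a b eq = begin
  x                               ≡⟨ solve 2 (λ x a → x := con ½ :* a :+ (con 1ℚ :- con ½) :* ((x :+ x) :- a)) refl x a ⟩
  ½ * a + (1ℚ - ½) * (x + x - a)  ≡⟨ cong (λ w → ½ * a + (1ℚ - ½) * (w - a)) eq ⟨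
  ½ * a + (1ℚ - ½) * (a + b - a)  ≡⟨ cong (λ w → ½ * a + (1ℚ - ½) * w) (solve 2 (λ a b → a :+ b :- a := b) refl a b) ⟩
  ½ * a + (1ℚ - ½) * b            ∎
  where open ≡-Reasoning

0≤q-p⇒p≤q : ∀ {p q} → 0ℚ ≤ q - p → p ≤ q
0≤q-p⇒p≤q {p} {q} h =
  subst₂ _≤_ (+-identityˡ p) (solve 2 (λ p q → q :- p :+ p := q) refl p q) (+-monoˡ-≤ p h)

p≤q⇒0≤q-p : ∀ {p q} → p ≤ q → 0ℚ ≤ q - p
p≤q⇒0≤q-p {p} {q} h = subst (_≤ q - p) (+-inverseʳ p) (+-monoˡ-≤ (- p) h)

p≤q⇒p-q≤0 : ∀ {p q} → p ≤ q → p - q ≤ 0ℚ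
p≤q⇒p-q≤0 {p} {q} h = subst (p - q ≤_) (+-inverseʳ q) (+-monoˡ-≤ (- q) h)

p+[p-q]≡p⇒p≡q : ∀ {p q} → p + (p - q) ≡ p → p ≡ q
p+[p-q]≡p⇒p≡q {p} {q} eq = begin
  p              ≡⟨ solve 2 (λ p q → p := q :+ (p :- q)) refl p q ⟩
  q + (p - q)    ≡⟨ cong (λ w → q + w) (p+q≡p⇒q≡0 eq) ⟩
  q + 0ℚ         ≡⟨ +-identityʳ q ⟩
  q              ∎
  where open ≡-Reasoning

±-nonneg : ∀ {s x} → 0ℚ ≤ s → s ≤ x → 0ℚ ≤ x + s × 0ℚ ≤ x - s
±-nonneg {s} {x} 0≤s s≤x = +-mono-≤ (≤-trans 0≤s s≤x) 0≤s , p≤q⇒0≤q-p s≤x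

∓-nonneg : ∀ {s x} → 0ℚ ≤ s → s ≤ x → 0ℚ ≤ x + - s × 0ℚ ≤ x - - s
∓-nonneg {s} {x} 0≤s s≤x with ±-nonneg 0≤s s≤x
... | plus , minus = minus , subst (0ℚ ≤_) (solve 2 (λ x s → x :+ s := x :- (:- s)) refl x s) plus

p⊓q-q⊓p≡0 : ∀ p q → p ⊓ q - q ⊓ p ≡ 0ℚ
p⊓q-q⊓p≡0 p q = trans (cong (λ w → p ⊓ q - w) (⊓-comm q p)) (+-inverseʳ (p ⊓ q))

⊓≡0 : ∀ p q → p ⊓ q ≡ 0ℚ → p ≡ 0ℚ ⊎ q ≡ 0ℚ
⊓≡0 p q eq with ⊓-sel p q
... | inj₁ p⊓q≡p = inj₁ (trans (sym p⊓q≡p) eq)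
... | inj₂ p⊓q≡q = inj₂ (trans (sym p⊓q≡q) eq)

ZeroOne : ℚ → Set
ZeroOne p = p ≡ 0ℚ ⊎ p ≡ 1ℚ

record CoverPreserving (f g : ℚ → ℚ) : Set where
  field
    f-zero : f 0ℚ ≡ 0ℚ
    g-zero : g 0ℚ ≡ 0ℚ
    f-mono : ∀ {u v} → u ≤ v → f u ≤ f v
    g-mono : ∀ {u v} → u ≤ v → g u ≤ g v
    covers : ∀ u v → 1ℚ ≤ u + v → 1ℚ ≤ f u + g v

  f-nonneg : ∀ {v} → 0ℚ ≤ v → 0ℚ ≤ f v
  f-nonneg 0≤v = subst (_≤ f _) f-zero (f-mono 0≤v)

  g-nonneg : ∀ {v} → 0ℚ ≤ v → 0ℚ ≤ g v
  g-nonneg 0≤v = subst (_≤ g _) g-zero (g-mono 0≤v)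

  cover-swapped : ∀ u v → 1ℚ ≤ u + v → 1ℚ ≤ g u + f v
  cover-swapped u v h = subst (1ℚ ≤_) (+-comm (f v) (g u)) (covers v u (subst (1ℚ ≤_) (+-comm u v) h))

  cover-one-zero : ∀ x y z → x ≡ 0ℚ ⊎ y ≡ 0ℚ → 1ℚ ≤ x + y + z → 1ℚ ≤ g x + g y + f z
  cover-one-zero .0ℚ y z (inj₁ refl) h =
    subst (1ℚ ≤_) (sym (cong (λ w → w + f z) (trans (cong (_+ g y) g-zero) (+-identityˡ (g y)))))
      (cover-swapped y z (subst (1ℚ ≤_) (cong (_+ z) (+-identityˡ y)) h))
  cover-one-zero x .0ℚ z (inj₂ refl) h =
    subst (1ℚ ≤_) (sym (cong (λ w → w + f z) (trans (cong (g x +_) g-zero) (+-identityʳ (g x)))))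
      (cover-swapped x z (subst (1ℚ ≤_) (cong (_+ z) (+-identityʳ x)) h))

swap : ∀ {f g} → CoverPreserving f g → CoverPreserving g f
swap c = record { f-zero = g-zero ; g-zero = f-zero ; f-mono = g-mono ; g-mono = f-mono ; covers = cover-swapped }
  where open CoverPreserving c

low : ℚ → ℚ
low v = (v + v) ⊓ 1ℚ

high : ℚ → ℚ
high v = (v + v - 1ℚ) ⊔ 0ℚ

low+high : ∀ v → low v + high v ≡ v + v
low+high v with ≤-total (v + v) 1ℚ
... | inj₁ 2v≤1 = begin
  low v + high v  ≡⟨ cong₂ _+_ (p≤q⇒p⊓q≡p 2v≤1) (p≤q⇒p⊔q≡q (p≤q⇒p-q≤0 2v≤1)) ⟩
  (v + v) + 0ℚ    ≡⟨ +-identityʳ (v + v) ⟩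
  v + v           ∎
  where open ≡-Reasoning
... | inj₂ 1≤2v = begin
  low v + high v       ≡⟨ cong₂ _+_ (p≥q⇒p⊓q≡q 1≤2v) (p≥q⇒p⊔q≡p (p≤q⇒0≤q-p 1≤2v)) ⟩
  1ℚ + (v + v - 1ℚ)    ≡⟨ solve 1 (λ v → con 1ℚ :+ (v :+ v :- con 1ℚ) := v :+ v) refl v ⟩
  v + v                ∎
  where open ≡-Reasoning

low-high-cover : CoverPreserving low high
low-high-cover = record
  { f-zero = refl
  ; g-zero = refl
  ; f-mono = λ u≤v → ⊓-monoˡ-≤ 1ℚ (+-mono-≤ u≤v u≤v)
  ; g-mono = λ u≤v → ⊔-monoˡ-≤ 0ℚ (+-monoˡ-≤ (- 1ℚ) (+-mono-≤ u≤v u≤v))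
  ; covers = covers
  }
  where
  covers : ∀ u v → 1ℚ ≤ u + v → 1ℚ ≤ low u + high v
  covers u v 1≤u+v with ≤-total (u + u) 1ℚ
  ... | inj₁ 2u≤1 = begin
    1ℚ                      ≤⟨ 0≤q-p⇒p≤q (subst (0ℚ ≤_) excess≡ (+-mono-≤ excess≥0 excess≥0)) ⟩
    (u + u) + (v + v - 1ℚ)  ≤⟨ +-monoʳ-≤ (u + u) (p≤p⊔q (v + v - 1ℚ) 0ℚ) ⟩
    (u + u) + high v        ≡⟨ cong (_+ high v) (p≤q⇒p⊓q≡p 2u≤1) ⟨
    low u + high v          ∎
    where
    open ≤-Reasoning
    excess≥0 : 0ℚ ≤ u + v - 1ℚ
    excess≥0 = p≤q⇒0≤q-p 1≤u+v
    excess≡ : (u + v - 1ℚ) + (u + v - 1ℚ) ≡ (u + u) + (v + v - 1ℚ) - 1ℚ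
    excess≡ = solve 2 (λ u v → (u :+ v :- con 1ℚ) :+ (u :+ v :- con 1ℚ) := (u :+ u) :+ (v :+ v :- con 1ℚ) :- con 1ℚ) refl u v
  ... | inj₂ 1≤2u = begin
    1ℚ              ≡⟨ +-identityʳ 1ℚ ⟨
    1ℚ + 0ℚ         ≤⟨ +-monoʳ-≤ 1ℚ (p≤q⊔p (v + v - 1ℚ) 0ℚ) ⟩
    1ℚ + high v     ≡⟨ cong (_+ high v) (p≥q⇒p⊓q≡q 1≤2u) ⟨
    low u + high v  ∎
    where open ≤-Reasoning

low-fixed : ∀ {v} → low v ≡ v → ZeroOne v
low-fixed {v} eq with ≤-total (v + v) 1ℚ
... | inj₁ 2v≤1 = inj₁ (p+q≡p⇒q≡0 (trans (sym (p≤q⇒p⊓q≡p 2v≤1)) eq))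
... | inj₂ 1≤2v = inj₂ (trans (sym eq) (p≥q⇒p⊓q≡q 1≤2v))

high-fixed : ∀ {v} → high v ≡ v → ZeroOne v
high-fixed {v} eq with ≤-total (v + v - 1ℚ) 0ℚ
... | inj₁ 2v-1≤0 = inj₁ (trans (sym eq) (p≤q⇒p⊔q≡q 2v-1≤0))
... | inj₂ 0≤2v-1 = inj₂ (p+[p-q]≡p⇒p≡q (trans (sym (+-assoc v v (- 1ℚ))) (trans (sym (p≥q⇒p⊔q≡p 0≤2v-1)) eq)))

IsInt-+ : ∀ {p q} → IsInt p → IsInt q → IsInt (p + q)
IsInt-+ (x , refl) (y , refl) =
  x ℤ.+ y , trans (sym (fromℚᵘ-toℚᵘ (x / 1 + y / 1))) (fromℚᵘ-cong sum≃)
  where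
  sum≃ : toℚᵘ (x / 1 + y / 1) ℚᵘ.≃ ℚᵘ.mkℚᵘ (x ℤ.+ y) 0
  sum≃ = ℚᵘ.≃-trans (toℚᵘ-homo-+ (x / 1) (y / 1))
           (ℚᵘ.≃-trans (ℚᵘ.+-cong (toℚᵘ-fromℚᵘ (ℚᵘ.mkℚᵘ x 0)) (toℚᵘ-fromℚᵘ (ℚᵘ.mkℚᵘ y 0)))
             (ℚᵘ.≃-reflexive (cong (λ z → ℚᵘ.mkℚᵘ z 0) (cong₂ ℤ._+_ (ℤ.*-identityʳ x) (ℤ.*-identityʳ y)))))

IsInt-0 : IsInt 0ℚ
IsInt-0 = ℤ.+ 0 , refl

ZeroOne⇒IsInt : ∀ {p} → ZeroOne p → IsInt p
ZeroOne⇒IsInt (inj₁ refl) = IsInt-0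
ZeroOne⇒IsInt (inj₂ refl) = ℤ.+ 1 , refl

when-+ : ∀ {P : Set} (d : Dec P) p q → when d (p + q) ≡ when d p + when d q
when-+ (yes _) p q = refl
when-+ (no _)  p q = refl

when-IsInt : ∀ {P : Set} (d : Dec P) {p} → IsInt p → IsInt (when d p)
when-IsInt (yes _) int = int
when-IsInt (no _)  int = IsInt-0

sumFin-cong : ∀ {m} {f g : Fin m → ℚ} → (∀ k → f k ≡ g k) → sumFin f ≡ sumFin g
sumFin-cong {zero}  eq = refl
sumFin-cong {suc m} eq = cong₂ _+_ (eq zero) (sumFin-cong (λ k → eq (suc k)))

sumFin-zero : ∀ {m} {f : Fin m → ℚ} → (∀ k → f k ≡ 0ℚ) → sumFin f ≡ 0ℚ
sumFin-zero {zero}  eq = refl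
sumFin-zero {suc m} eq = cong₂ _+_ (eq zero) (sumFin-zero (λ k → eq (suc k)))

sumFin-+ : ∀ {m} (f g : Fin m → ℚ) → sumFin (λ k → f k + g k) ≡ sumFin f + sumFin g
sumFin-+ {zero}  f g = refl
sumFin-+ {suc m} f g = begin
  (f zero + g zero) + sumFin (λ k → f (suc k) + g (suc k))  ≡⟨ cong (λ w → (f zero + g zero) + w) (sumFin-+ (λ k → f (suc k)) (λ k → g (suc k))) ⟩
  (f zero + g zero) + (F + G)                               ≡⟨ solve 4 (λ a b A B → (a :+ b) :+ (A :+ B) := (a :+ A) :+ (b :+ B)) refl (f zero) (g zero) F G ⟩
  (f zero + F) + (g zero + G)                               ∎
  where
  open ≡-Reasoning
  F = sumFin (λ k → f (suc k))
  G = sumFin (λ k → g (suc k))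

sumFin-IsInt : ∀ {m} {f : Fin m → ℚ} → (∀ k → IsInt (f k)) → IsInt (sumFin f)
sumFin-IsInt {zero}  int = IsInt-0
sumFin-IsInt {suc m} int = IsInt-+ (int zero) (sumFin-IsInt (λ k → int (suc k)))

indegree : ∀ {m} → (Fin m → Fin m → ℚ) → Fin m → ℚ
indegree X i = sumFin (λ j → when (¬? (j ≟ i)) (X j i))

indegree-cong : ∀ {m} {X Y : Fin m → Fin m → ℚ} → (∀ i j → X i j ≡ Y i j) → ∀ i → indegree X i ≡ indegree Y i
indegree-cong eq i = sumFin-cong (λ j → cong (when (¬? (j ≟ i))) (eq j i))

indegree-+ : ∀ {m} (X Y : Fin m → Fin m → ℚ) i → indegree (λ j k → X j k + Y j k) i ≡ indegree X i + indegree Y i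
indegree-+ X Y i = trans (sumFin-cong (λ j → when-+ (¬? (j ≟ i)) (X j i) (Y j i)))
                         (sumFin-+ (λ j → when (¬? (j ≟ i)) (X j i)) (λ j → when (¬? (j ≟ i)) (Y j i)))

tight : ∀ {m} → (Fin m → Fin m → ℚ) → (Fin m → Fin m → Fin m → ℚ) → Point m
tight X Z = pt (indegree X) X Z

module Vertex {m : ℕ} (Btw : Fin m → Fin m → Fin m → Set) (btw? : ∀ k i j → Dec (Btw k i j)) where

  open STT Btw btw?

  IsMidpoint : Point m → Point m → Point m → Set
  IsMidpoint p q r = (∀ i → D q i + D r i ≡ D p i + D p i)
                   × (∀ i j → X q i j + X r i j ≡ X p i j + X p i j)
                   × (∀ k i j → Z q k i j + Z r k i j ≡ Z p k i j + Z p k i j)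

  vertex-midpoint : ∀ {p q r} → IsVertex p → InP q → InP r → IsMidpoint p q r → q ≐ p
  vertex-midpoint {p} {q} {r} (_ , extreme) q∈P r∈P (mD , mX , mZ) =
    (λ i → equal-halves (mD i) (proj₁ q≐r i))
    , (λ i j → equal-halves (mX i j) (proj₁ (proj₂ q≐r) i j))
    , (λ k i j → equal-halves (mZ k i j) (proj₂ (proj₂ q≐r) k i j))
    where
    q≐r : q ≐ r
    q≐r = extreme q r ½ q∈P r∈P 0<½ ½<1
            ( (λ i → sum≡double⇒midpoint (D q i) (D r i) (mD i))
            , (λ i j → sum≡double⇒midpoint (X q i j) (X r i j) (mX i j))
            , (λ k i j → sum≡double⇒midpoint (Z q k i j) (Z r k i j) (mZ k i j)) )
    equal-halves : ∀ {a b c} → a + b ≡ c + c → a ≡ b → a ≡ c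
    equal-halves {a} sum a≡b = double-injective (trans (cong (λ w → a + w) a≡b) sum)

  InP-withD : ∀ {p} → InP p → (D′ : Fin m → ℚ) → (∀ i → indegree (X p) i ≤ D′ i) → InP (pt D′ (X p) (Z p))
  InP-withD p∈P D′ bound = record
    { X-diag = X-diag ; Z-off = Z-off ; Z-sym = Z-sym ; X-nonneg = X-nonneg ; Z-nonneg = Z-nonneg
    ; cover = cover ; Z≤Xki = Z≤Xki ; Z≤Xkj = Z≤Xkj ; D-bound = bound }
    where open InP p∈P

  InP⇒X-nonneg : ∀ {p} → InP p → ∀ i j → 0ℚ ≤ X p i j
  InP⇒X-nonneg p∈P i j with i ≟ j
  ... | yes refl = ≤-reflexive (sym (InP.X-diag p∈P i))
  ... | no i≢j   = InP.X-nonneg p∈P i j i≢j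

  vertex-indegree-tight : ∀ {p} → IsVertex p → ∀ i → D p i ≡ indegree (X p) i
  vertex-indegree-tight {p} vertex@(p∈P , _) i =
    p+[p-q]≡p⇒p≡q (proj₁ (vertex-midpoint vertex q∈P r∈P (mD , (λ i j → refl) , (λ k i j → refl))) i)
    where
    open InP p∈P using (D-bound)
    slack : Fin m → ℚ
    slack i = D p i - indegree (X p) i
    q∈P : InP (pt (λ i → D p i + slack i) (X p) (Z p))
    q∈P = InP-withD p∈P _ λ i →
      0≤q-p⇒p≤q (subst (0ℚ ≤_) (solve 2 (λ d s → (d :- s) :+ (d :- s) := d :+ (d :- s) :- s) refl (D p i) (indegree (X p) i))
                  (+-mono-≤ (p≤q⇒0≤q-p (D-bound i)) (p≤q⇒0≤q-p (D-bound i))))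
    r∈P : InP (tight (X p) (Z p))
    r∈P = InP-withD p∈P _ (λ i → ≤-refl)
    mD : ∀ i → (D p i + slack i) + indegree (X p) i ≡ D p i + D p i
    mD i = solve 2 (λ d s → (d :+ (d :- s)) :+ s := d :+ d) refl (D p i) (indegree (X p) i)

  vertex-tight-split : ∀ {p} → IsVertex p
    → (QX RX : Fin m → Fin m → ℚ) (QZ RZ : Fin m → Fin m → Fin m → ℚ)
    → (∀ i j → QX i j + RX i j ≡ X p i j + X p i j)
    → (∀ k i j → QZ k i j + RZ k i j ≡ Z p k i j + Z p k i j)
    → InP (tight QX QZ) → InP (tight RX RZ)
    → (∀ i j → QX i j ≡ X p i j) × (∀ k i j → QZ k i j ≡ Z p k i j)
  vertex-tight-split {p} vertex QX RX QZ RZ mX mZ q∈P r∈P =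
    proj₁ (proj₂ q≐p) , proj₂ (proj₂ q≐p)
    where
    mD : ∀ i → indegree QX i + indegree RX i ≡ D p i + D p i
    mD i = begin
      indegree QX i + indegree RX i        ≡⟨ indegree-+ QX RX i ⟨
      indegree (λ j k → QX j k + RX j k) i ≡⟨ indegree-cong mX i ⟩
      indegree (λ j k → X p j k + X p j k) i ≡⟨ indegree-+ (X p) (X p) i ⟩
      indegree (X p) i + indegree (X p) i  ≡⟨ cong₂ _+_ (vertex-indegree-tight vertex i) (vertex-indegree-tight vertex i) ⟨
      D p i + D p i                        ∎
      where open ≡-Reasoning
    q≐p : tight QX QZ ≐ p
    q≐p = vertex-midpoint vertex q∈P r∈P (mD , mX , mZ)

  InP-antisymmetric-shift : ∀ {p} → InP p → (ε : Fin m → Fin m → ℚ)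
    → (∀ i j → ε i j + ε j i ≡ 0ℚ)
    → (∀ i j → 0ℚ ≤ X p i j + ε i j)
    → (∀ k i j → Btw k i j → ε k i ≡ 0ℚ × ε k j ≡ 0ℚ)
    → InP (tight (λ i j → X p i j + ε i j) (Z p))
  InP-antisymmetric-shift {p} p∈P ε antisym nonneg fixed = record
    { X-diag   = λ i → cong₂ _+_ (X-diag i) (double-injective {q = 0ℚ} (antisym i i))
    ; Z-off    = Z-off
    ; Z-sym    = Z-sym
    ; X-nonneg = λ i j _ → nonneg i j
    ; Z-nonneg = Z-nonneg
    ; cover    = λ i j i≢j → subst (1ℚ ≤_) (sym (cover-unchanged i j)) (cover i j i≢j)
    ; Z≤Xki    = λ k i j i≢j b → ≤-+fixed (proj₁ (fixed k i j b)) (Z≤Xki k i j i≢j b)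
    ; Z≤Xkj    = λ k i j i≢j b → ≤-+fixed (proj₂ (fixed k i j b)) (Z≤Xkj k i j i≢j b)
    ; D-bound  = λ i → ≤-refl
    }
    where
    open InP p∈P
    ≤-+fixed : ∀ {a b e} → e ≡ 0ℚ → a ≤ b → a ≤ b + e
    ≤-+fixed {a} {b} refl a≤b = subst (a ≤_) (sym (+-identityʳ b)) a≤b
    cover-unchanged : ∀ i j → let W = sumFin (λ k → when (btw? k i j) (Z p k i j)) in
      (X p i j + ε i j) + (X p j i + ε j i) + W ≡ X p i j + X p j i + W
    cover-unchanged i j = begin
      (X p i j + ε i j) + (X p j i + ε j i) + W  ≡⟨ solve 5 (λ a b c u v → a :+ u :+ (b :+ v) :+ c := a :+ b :+ c :+ (u :+ v)) refl (X p i j) (X p j i) W (ε i j) (ε j i) ⟩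
      X p i j + X p j i + W + (ε i j + ε j i)    ≡⟨ cong (λ w → X p i j + X p j i + W + w) (antisym i j) ⟩
      X p i j + X p j i + W + 0ℚ                 ≡⟨ +-identityʳ _ ⟩
      X p i j + X p j i + W                      ∎
      where
      open ≡-Reasoning
      W = sumFin (λ k → when (btw? k i j) (Z p k i j))

  vertex-antisymmetric-shift≡0 : ∀ {p} → IsVertex p → (ε : Fin m → Fin m → ℚ)
    → (∀ i j → ε i j + ε j i ≡ 0ℚ)
    → (∀ i j → 0ℚ ≤ X p i j + ε i j × 0ℚ ≤ X p i j - ε i j)
    → (∀ k i j → Btw k i j → ε k i ≡ 0ℚ × ε k j ≡ 0ℚ)
    → ∀ i j → ε i j ≡ 0ℚ
  vertex-antisymmetric-shift≡0 {p} vertex@(p∈P , _) ε antisym bounded fixed i j =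
    p+q≡p⇒q≡0 (proj₁ (vertex-tight-split vertex
      (λ i j → X p i j + ε i j) (λ i j → X p i j - ε i j) (Z p) (Z p)
      (λ i j → solve 2 (λ x e → (x :+ e) :+ (x :- e) := x :+ x) refl (X p i j) (ε i j)) (λ k i j → refl)
      (InP-antisymmetric-shift p∈P ε antisym (λ i j → proj₁ (bounded i j)) fixed)
      (InP-antisymmetric-shift p∈P (λ i j → - ε i j) antisym-neg (λ i j → proj₂ (bounded i j)) fixed-neg))
      i j)
    where
    antisym-neg : ∀ i j → - ε i j + - ε j i ≡ 0ℚ
    antisym-neg i j = trans (sym (neg-distrib-+ (ε i j) (ε j i))) (cong -_ (antisym i j))
    fixed-neg : ∀ k i j → Btw k i j → - ε k i ≡ 0ℚ × - ε k j ≡ 0ℚ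
    fixed-neg k i j b = cong -_ (proj₁ (fixed k i j b)) , cong -_ (proj₂ (fixed k i j b))

module Star (n : ℕ) where

  open StarSTT n
  open Vertex (StarBtw {n}) starBtw?

  Node : Set
  Node = Fin (suc n)

  star-between-sum : (f : Node → ℚ) (i j : Node) →
    sumFin (λ k → when (starBtw? k i j) (f k)) ≡ when (starBtw? zero i j) (f zero)
  star-between-sum f i j =
    trans (cong (λ w → when (starBtw? zero i j) (f zero) + w) (sumFin-zero {f = leafTerms} (λ k → refl)))
          (+-identityʳ _)
    where
    leafTerms : Fin n → ℚ
    leafTerms k = when (starBtw? (suc k) i j) (f (suc k))

  -- Comparing a with b only serves to make the shift antisymmetric.
  leafShift : (Node → Node → ℚ) → Node → Node → ℚ
  leafShift X (suc a) (suc b) with <-cmp a b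
  ... | tri< _ _ _ = X (suc a) (suc b) ⊓ X (suc b) (suc a)
  ... | tri≈ _ _ _ = 0ℚ
  ... | tri> _ _ _ = - (X (suc a) (suc b) ⊓ X (suc b) (suc a))
  leafShift X _ _ = 0ℚ

  leafShift-antisym : ∀ X i j → leafShift X i j + leafShift X j i ≡ 0ℚ
  leafShift-antisym X zero    zero    = refl
  leafShift-antisym X zero    (suc b) = refl
  leafShift-antisym X (suc a) zero    = refl
  leafShift-antisym X (suc a) (suc b) with <-cmp a b | <-cmp b a
  ... | tri< _ _ _     | tri> _ _ _     = p⊓q-q⊓p≡0 (X (suc a) (suc b)) (X (suc b) (suc a))
  ... | tri> _ _ _     | tri< _ _ _     =
    trans (+-comm (- (X (suc a) (suc b) ⊓ X (suc b) (suc a))) (X (suc b) (suc a) ⊓ X (suc a) (suc b)))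
          (p⊓q-q⊓p≡0 (X (suc b) (suc a)) (X (suc a) (suc b)))
  ... | tri≈ _ _ _     | tri≈ _ _ _     = refl
  ... | tri< _ _ b≮a   | tri< b<a _ _   = ⊥-elim (b≮a b<a)
  ... | tri< _ a≢b _   | tri≈ _ b≡a _   = ⊥-elim (a≢b (sym b≡a))
  ... | tri≈ _ a≡b _   | tri< _ b≢a _   = ⊥-elim (b≢a (sym a≡b))
  ... | tri≈ _ a≡b _   | tri> _ b≢a _   = ⊥-elim (b≢a (sym a≡b))
  ... | tri> _ a≢b _   | tri≈ _ b≡a _   = ⊥-elim (a≢b (sym b≡a))
  ... | tri> _ _ b<a   | tri> b≮a _ _   = ⊥-elim (b≮a b<a)

  leafShift-bounded : ∀ X → (∀ i j → 0ℚ ≤ X i j) →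
    ∀ i j → 0ℚ ≤ X i j + leafShift X i j × 0ℚ ≤ X i j - leafShift X i j
  leafShift-bounded X X≥0 zero    j       = ±-nonneg ≤-refl (X≥0 zero j)
  leafShift-bounded X X≥0 (suc a) zero    = ±-nonneg ≤-refl (X≥0 (suc a) zero)
  leafShift-bounded X X≥0 (suc a) (suc b) with <-cmp a b
  ... | tri< _ _ _ = ±-nonneg (⊓-glb (X≥0 (suc a) (suc b)) (X≥0 (suc b) (suc a))) (p⊓q≤p (X (suc a) (suc b)) (X (suc b) (suc a)))
  ... | tri≈ _ _ _ = ±-nonneg ≤-refl (X≥0 (suc a) (suc b))
  ... | tri> _ _ _ = ∓-nonneg (⊓-glb (X≥0 (suc a) (suc b)) (X≥0 (suc b) (suc a))) (p⊓q≤p (X (suc a) (suc b)) (X (suc b) (suc a)))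

  leafShift≡0⇒exclusive : ∀ X → (∀ i → X i i ≡ 0ℚ) → ∀ a b → leafShift X (suc a) (suc b) ≡ 0ℚ →
    X (suc a) (suc b) ≡ 0ℚ ⊎ X (suc b) (suc a) ≡ 0ℚ
  leafShift≡0⇒exclusive X diag a b shift≡0 with <-cmp a b
  ... | tri< _ _ _    = ⊓≡0 (X (suc a) (suc b)) (X (suc b) (suc a)) shift≡0
  ... | tri≈ _ refl _ = inj₁ (diag (suc a))
  ... | tri> _ _ _    = ⊓≡0 (X (suc a) (suc b)) (X (suc b) (suc a)) (neg-injective {q = 0ℚ} shift≡0)

  vertex-leaves-exclusive : ∀ {p} → IsVertex p →
    ∀ a b → X p (suc a) (suc b) ≡ 0ℚ ⊎ X p (suc b) (suc a) ≡ 0ℚ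
  vertex-leaves-exclusive {p} vertex@(p∈P , _) a b =
    leafShift≡0⇒exclusive (X p) (InP.X-diag p∈P) a b
      (vertex-antisymmetric-shift≡0 vertex (leafShift (X p)) (leafShift-antisym (X p))
        (leafShift-bounded (X p) (InP⇒X-nonneg p∈P)) (λ { .zero i j (refl , _) → refl , refl })
        (suc a) (suc b))

  byRow : (ℚ → ℚ) → (ℚ → ℚ) → Node → ℚ → ℚ
  byRow f g zero    = f
  byRow f g (suc _) = g

  rowwise : (ℚ → ℚ) → (ℚ → ℚ) → Point (suc n) → Point (suc n)
  rowwise f g p = tight (λ i j → byRow f g i (X p i j)) (λ k i j → f (Z p k i j))

  InP-rowwise : ∀ {f g p} → CoverPreserving f g → InP p →
    (∀ a b → X p (suc a) (suc b) ≡ 0ℚ ⊎ X p (suc b) (suc a) ≡ 0ℚ) → InP (rowwise f g p)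
  InP-rowwise {f} {g} {p} fg p∈P exclusive = record
    { X-diag   = λ i → trans (cong (byRow f g i) (X-diag i)) (byRow-zero i)
    ; Z-off    = λ k i j ¬b → trans (cong f (Z-off k i j ¬b)) f-zero
    ; Z-sym    = λ k i j b → cong f (Z-sym k i j b)
    ; X-nonneg = λ i j i≢j → byRow-nonneg i (X-nonneg i j i≢j)
    ; Z-nonneg = λ k i j i≢j b → f-nonneg (Z-nonneg k i j i≢j b)
    ; cover    = λ i j i≢j →
        subst (λ w → 1ℚ ≤ byRow f g i (X p i j) + byRow f g j (X p j i) + w)
          (sym (star-between-sum (λ k → f (Z p k i j)) i j))
          (cover-star i j i≢j (starBtw? zero i j)
            (subst (λ w → 1ℚ ≤ X p i j + X p j i + w) (star-between-sum (λ k → Z p k i j) i j) (cover i j i≢j)))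
    ; Z≤Xki    = λ { .zero i j i≢j b@(refl , _) → f-mono (Z≤Xki zero i j i≢j b) }
    ; Z≤Xkj    = λ { .zero i j i≢j b@(refl , _) → f-mono (Z≤Xkj zero i j i≢j b) }
    ; D-bound  = λ i → ≤-refl
    }
    where
    open InP p∈P
    open CoverPreserving fg
    byRow-zero : ∀ i → byRow f g i 0ℚ ≡ 0ℚ
    byRow-zero zero    = f-zero
    byRow-zero (suc _) = g-zero
    byRow-nonneg : ∀ i {v} → 0ℚ ≤ v → 0ℚ ≤ byRow f g i v
    byRow-nonneg zero    = f-nonneg
    byRow-nonneg (suc _) = g-nonneg
    cover-star : ∀ i j → i ≢ j → (btw : Dec (StarBtw zero i j)) →
      1ℚ ≤ X p i j + X p j i + when btw (Z p zero i j) →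
      1ℚ ≤ byRow f g i (X p i j) + byRow f g j (X p j i) + when btw (f (Z p zero i j))
    cover-star zero    zero    i≢j _ _ = ⊥-elim (i≢j refl)
    cover-star zero    (suc b) _   (no _) h =
      subst (1ℚ ≤_) (sym (+-identityʳ (f x + g y))) (covers x y (subst (1ℚ ≤_) (+-identityʳ (x + y)) h))
      where x = X p zero (suc b); y = X p (suc b) zero
    cover-star (suc a) zero    _   (no _) h =
      subst (1ℚ ≤_) (sym (+-identityʳ (g x + f y))) (cover-swapped x y (subst (1ℚ ≤_) (+-identityʳ (x + y)) h))
      where x = X p (suc a) zero; y = X p zero (suc a)
    cover-star (suc a) (suc b) _   (yes _) h = cover-one-zero (X p (suc a) (suc b)) (X p (suc b) (suc a)) (Z p zero (suc a) (suc b)) (exclusive a b) h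
    cover-star zero    _       _   (yes (_ , 0≢0 , _)) _ = ⊥-elim (0≢0 refl)
    cover-star (suc a) zero    _   (yes (_ , _ , 0≢0 , _)) _ = ⊥-elim (0≢0 refl)
    cover-star (suc a) (suc b) a≢b (no ¬btw) _ = ⊥-elim (¬btw (refl , (λ ()) , (λ ()) , a≢b))

  vertex-rowwise-fixed : ∀ {p} → IsVertex p →
    (∀ i j → byRow low high i (X p i j) ≡ X p i j) × (∀ k i j → low (Z p k i j) ≡ Z p k i j)
  vertex-rowwise-fixed {p} vertex@(p∈P , _) =
    vertex-tight-split vertex (λ i j → byRow low high i (X p i j)) (λ i j → byRow high low i (X p i j))
      (λ k i j → low (Z p k i j)) (λ k i j → high (Z p k i j)) sumX (λ k i j → low+high (Z p k i j))
      (InP-rowwise low-high-cover p∈P exclusive) (InP-rowwise (swap low-high-cover) p∈P exclusive)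
    where
    exclusive : ∀ a b → X p (suc a) (suc b) ≡ 0ℚ ⊎ X p (suc b) (suc a) ≡ 0ℚ
    exclusive = vertex-leaves-exclusive vertex
    sumX : ∀ i j → byRow low high i (X p i j) + byRow high low i (X p i j) ≡ X p i j + X p i j
    sumX zero    j = low+high (X p zero j)
    sumX (suc a) j = trans (+-comm (high (X p (suc a) j)) (low (X p (suc a) j))) (low+high (X p (suc a) j))

  vertex-X-ZeroOne : ∀ {p} → IsVertex p → ∀ i j → ZeroOne (X p i j)
  vertex-X-ZeroOne vertex zero    j = low-fixed (proj₁ (vertex-rowwise-fixed vertex) zero j)
  vertex-X-ZeroOne vertex (suc a) j = high-fixed (proj₁ (vertex-rowwise-fixed vertex) (suc a) j)

  vertex-Z-ZeroOne : ∀ {p} → IsVertex p → ∀ k i j → ZeroOne (Z p k i j)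
  vertex-Z-ZeroOne vertex k i j = low-fixed (proj₂ (vertex-rowwise-fixed vertex) k i j)

theorem3p9 : (n : ℕ) (p : Point (suc n)) → StarSTT.IsVertex n p → IsIntegral p
theorem3p9 n p vertex = D-int , X-int , Z-int
  where
  open Star n
  open Vertex (StarBtw {n}) starBtw? using (vertex-indegree-tight)
  X-int : ∀ i j → IsInt (X p i j)
  X-int i j = ZeroOne⇒IsInt (vertex-X-ZeroOne vertex i j)
  Z-int : ∀ k i j → IsInt (Z p k i j)
  Z-int k i j = ZeroOne⇒IsInt (vertex-Z-ZeroOne vertex k i j)
  D-int : ∀ i → IsInt (D p i)
  D-int i = subst IsInt (sym (vertex-indegree-tight vertex i))
                  (sumFin-IsInt (λ j → when-IsInt (¬? (j ≟ i)) (X-int j i)))
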